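{- The Härtig quantifier can be expressed in $\mathrm{MSO}(\mathrm{TC})$: for all $\mathrm{MSO}(\mathrm{TC})$-formulas $\varphi(x)$ and $\psi(y)$ (possibly with further free variables) there is an $\mathrm{MSO}(\mathrm{TC})$-formula $\chi$ such that for every appropriate finite structure $\mathfrak A$, $\mathfrak A\models\chi$ iff $\mathfrak A\models \mathrm H xy(\varphi(x),\psi(y))$.
   Context: $\mathrm{MSO}(\mathrm{TC})$: formulas built by $\varphi ::= x=y \mid X(x) \mid \neg\varphi \mid (\varphi\lor\varphi) \mid \exists x\,\varphi \mid \exists Y\,\varphi \mid [\mathrm{TC}_{\vec X,\vec X'}\varphi](\vec Y,\vec Y')$ with first-order variables $x,y$, monadic second-order variables $X,Y$, $\vec X,\vec X'$ disjoint tuples of variables of the same sort (positionwise both first-order or both monadic second-order) and $\vec Y,\vec Y'$ tuples of that sort. Structures $(A,I)$ are finite; $\mathfrak A\models[\mathrm{TC}_{\vec X,\vec X'}\varphi](\vec Y,\vec Y')$ iff $(I(\vec Y),I(\vec Y'))$ lies in the transitive closure of $\{(\vec R,\vec R')\mid\mathfrak A[\vec R/\vec X,\vec R'/\vec X']\models\varphi\}$. The Härtig quantifier: $\mathfrak A\models\mathrm H xy(\varphi(x),\psi(y))$ iff the sets $\{a\in A\mid\mathfrak A[a/x]\models\varphi\}$ and $\{b\in A\mid\mathfrak A[b/y]\models\psi\}$ have the same cardinality. -}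

module Defs where

open import Data.Nat using (ℕ)
open import Data.Fin using (Fin)
open import Data.Fin.Subset using (Subset; _∈_)
open import Data.Bool using (Bool)
open import Data.List using (List; []; _∷_; _++_)
open import Data.List.Relation.Unary.Unique.Propositional using (Unique)
open import Data.Product using (Σ; ∃; _×_; _,_)
open import Data.Sum using (_⊎_)
open import Data.Unit using (⊤)
open import Relation.Nullary using (¬_)
open import Relation.Binary.PropositionalEquality using (_≡_)
open import Relation.Binary.Construct.Closure.Transitive using (TransClosure)

data Sort : Set where
  fo so : Sort

-- Variables of each sort are named by natural numbers (separate namespaces).
-- A tuple of variables with sort signature ss.
data Tup : List Sort → Set where
  []  : Tup []
  _∷_ : ∀ {s ss} → ℕ → Tup ss → Tup (s ∷ ss)

vars : ∀ {ss} → Tup ss → List (Sort × ℕ)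
vars []                   = []
vars (_∷_ {s = s} v vs)   = (s , v) ∷ vars vs

data Form : Set where
  _≐_  : ℕ → ℕ → Form
  mem  : ℕ → ℕ → Form                     -- mem X x  is  X(x)
  ¬'   : Form → Form
  _∨'_ : Form → Form → Form
  ∃₁   : ℕ → Form → Form
  ∃₂   : ℕ → Form → Form
  -- TC ss X X' Y Y' φ  is  [TC_{X,X'} φ](Y,Y'), all tuples of sort signature ss
  TC   : (ss : List Sort) → Tup ss → Tup ss → Tup ss → Tup ss → Form → Form

WF : Form → Set
WF (x ≐ y)              = ⊤
WF (mem X x)            = ⊤
WF (¬' φ)               = WF φ
WF (φ ∨' ψ)             = WF φ × WF ψ
WF (∃₁ x φ)             = WF φ
WF (∃₂ X φ)             = WF φ
WF (TC ss X X' Y Y' φ)  = Unique (vars X ++ vars X') × WF φ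

Val : ℕ → Sort → Set
Val n fo = Fin n
Val n so = Subset n

data Vals (n : ℕ) : List Sort → Set where
  []  : Vals n []
  _∷_ : ∀ {s ss} → Val n s → Vals n ss → Vals n (s ∷ ss)

-- A finite structure (Fin n, I): I interprets all variables.
record Assign (n : ℕ) : Set where
  field
    foI : ℕ → Fin n
    soI : ℕ → Subset n
open Assign public

open import Data.Nat using (_≟_)
open import Relation.Nullary using (yes; no)

upd : ∀ {n} → Assign n → (s : Sort) → ℕ → Val n s → Assign n
upd ρ fo x a = record { foI = λ z → f z (z ≟ x) ; soI = soI ρ }
  where f : ∀ z → _ → Fin _
        f z (yes _) = a
        f z (no _)  = foI ρ z
upd ρ so X A = record { foI = foI ρ ; soI = λ z → f z (z ≟ X) }
  where f : ∀ z → _ → Subset _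
        f z (yes _) = A
        f z (no _)  = soI ρ z

updTup : ∀ {n ss} → Assign n → Tup ss → Vals n ss → Assign n
updTup ρ []                      []       = ρ
updTup ρ (_∷_ {s = s} v vs) (a ∷ as)      = updTup (upd ρ s v a) vs as

get : ∀ {n} → Assign n → (s : Sort) → ℕ → Val n s
get ρ fo x = foI ρ x
get ρ so X = soI ρ X

getTup : ∀ {n ss} → Assign n → Tup ss → Vals n ss
getTup ρ []                 = []
getTup ρ (_∷_ {s = s} v vs) = get ρ s v ∷ getTup ρ vs

Sat : ∀ {n} → Assign n → Form → Set
Sat ρ (x ≐ y)   = foI ρ x ≡ foI ρ y
Sat ρ (mem X x) = foI ρ x ∈ soI ρ X
Sat ρ (¬' φ)    = ¬ Sat ρ φ
Sat ρ (φ ∨' ψ)  = Sat ρ φ ⊎ Sat ρ ψ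
Sat ρ (∃₁ x φ)  = ∃ λ a → Sat (upd ρ fo x a) φ
Sat ρ (∃₂ X φ)  = ∃ λ A → Sat (upd ρ so X A) φ
Sat {n} ρ (TC ss X X' Y Y' φ) =
  TransClosure (λ (R R' : Vals n ss) → Sat (updTup (updTup ρ X R) X' R') φ)
               (getTup ρ Y) (getTup ρ Y')

Equinumerous : ∀ {n} → (Fin n → Set) → (Fin n → Set) → Set
Equinumerous {n} P Q =
  Σ (Fin n → Fin n) λ f →
    (∀ a → P a → Q (f a)) ×
    (∀ a a' → P a → P a' → f a ≡ f a' → a ≡ a') ×
    (∀ b → Q b → ∃ λ a → P a × f a ≡ b)

Haertig : ∀ {n} → Assign n → ℕ → Form → ℕ → Form → Set
Haertig ρ x φ y ψ =
  Equinumerous (λ a → Sat (upd ρ fo x a) φ) (λ b → Sat (upd ρ fo y b) ψ)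

-- χ guesses P = {a ∣ φ(a)} and Q = {b ∣ ψ(b)} and asserts, by a transitive closure over
-- pairs of sets, that (P, Q) is reached from some pair (S, S) by steps each of which either
-- adds one new element to both sets or changes nothing. Such steps preserve equinumerosity,
-- and S is equinumerous with itself; conversely, removing matched pairs one at a time from a
-- bijection P → Q yields a chain down to (∅, ∅). Constructively, P and Q exist and the
-- classical connectives ∧, ⇔, ∀ (defined from ¬, ∨, ∃) behave as expected because
-- satisfaction is decidable: every quantifier ranges over a finite set, and transitive
-- closure on a finite type is decidable by Warshall's elimination of vertices.

module Submission where

open import Defs
open import Data.Bool using (true)
open import Data.Bool.Properties using (T-≡)
open import Data.Empty using (⊥-elim)
open import Data.Fin using (Fin; zero; suc)
open import Data.Fin.Properties using (any?; 2↔Bool; 1↔⊤; *↔×) renaming (_≟_ to _≟ᶠ_)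
open import Data.Fin.Subset using (Subset; _∈_; _∉_; _∪_; ⁅_⁆; _-_; ⊥; ∣_∣; Empty)
open import Data.Fin.Subset.Properties
  using (_∈?_; anySubset?; ⊆-antisym; ∪⇔⊎; x∈⁅y⁆⇔x≡y; p─q⊆p; x∈p∧x≢y⇒x∈p-y; nonempty?; Empty-unique;
         x∈p⇒∣p-x∣<∣p∣)
open import Data.List using ([]; _∷_)
open import Data.List.Relation.Unary.Unique.Propositional using (Unique)
open import Data.List.Relation.Unary.AllPairs using ([]; _∷_)
open import Data.List.Relation.Unary.All using ([]; _∷_)
open import Data.Nat using (ℕ; zero; suc; _+_; _*_; _⊔_; _<_; _≤_; _≟_)
open import Data.Nat.Properties using (m⊔n<o⇒m<o; m⊔n<o⇒n<o; <⇒≢; <-≤-trans; ≤-refl; m≤n+m; +-cancelʳ-≡)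
open import Data.Nat.Induction using (<-wellFounded)
open import Induction.WellFounded using (Acc; acc)
open import Data.Product using (Σ; ∃; _×_; _,_; proj₁; proj₂; uncurry)
open import Data.Product.Function.NonDependent.Propositional using (_×-↔_; _×-⇔_)
open import Data.Product.Function.Dependent.Propositional using (Σ-⇔)
open import Data.Sum.Function.Propositional using (_⊎-⇔_)
open import Data.Sum using (_⊎_; inj₁; inj₂)
open import Data.Unit using (⊤; tt)
open import Data.Vec using (Vec; []; _∷_; there; tabulate; lookup)
open import Data.Vec.Properties using ([]=↔lookup; lookup∘tabulate)
open import Function using (id; _∘_; case_of_)
open import Function.Construct.Identity using (↠-id)
open import Function.Bundles using (_↔_; _⇔_; mk⇔; mk↔ₛ′; Inverse; Equivalence)
open import Function.Properties.Equivalence using () renaming (refl to ⇔-refl; sym to ⇔-sym; trans to ⇔-trans)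
open import Function.Related.Propositional using (equivalence; module EquationalReasoning)
open import Function.Related.TypeIsomorphisms using (Related-cong; ¬-cong-⇔)
open import Function.Properties.Inverse using (↔-refl; ↔-trans; ↔⇒⇔)
open import Level using (0ℓ)
open import Relation.Binary using (Rel; Decidable)
open import Relation.Unary using () renaming (Decidable to Decidable₁)
open import Relation.Binary.Construct.Closure.Transitive using (TransClosure; [_]; _∷_; _∷ʳ_; _++_)
open import Relation.Binary.PropositionalEquality using (_≡_; _≢_; refl; sym; trans; cong; cong₂; subst; subst₂)
open import Relation.Nullary using (Dec; yes; no; ¬_; ¬?)
open import Relation.Nullary.Decidable using (map′; _×-dec_; _⊎-dec_; decidable-stable; isYes; True; toWitness; fromWitness)

-- Decidability of satisfaction

TransClosure-map : ∀ {A B : Set} {R : Rel A 0ℓ} {S : Rel B 0ℓ} (f : A → B) →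
                   (∀ {a b} → R a b → S (f a) (f b)) →
                   ∀ {a b} → TransClosure R a b → TransClosure S (f a) (f b)
TransClosure-map f r⇒s [ r ]    = [ r⇒s r ]
TransClosure-map f r⇒s (r ∷ rs) = r⇒s r ∷ TransClosure-map f r⇒s rs

-- Warshall's elimination of vertex 0: R-paths are described by Rˢ-paths on the
-- remaining vertices, where a single Rˢ-step may detour through 0.
module EliminateZero {m : ℕ} (R : Rel (Fin (suc m)) 0ℓ) where

  Rˢ : Rel (Fin m) 0ℓ
  Rˢ i j = R (suc i) (suc j) ⊎ (R (suc i) zero × R zero (suc j))

  Rˢ* : Rel (Fin m) 0ℓ
  Rˢ* i j = i ≡ j ⊎ TransClosure Rˢ i j

  Path : Rel (Fin (suc m)) 0ℓ
  Path (suc i) (suc j) = TransClosure Rˢ i j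
  Path (suc i) zero    = ∃ λ k → Rˢ* i k × R (suc k) zero
  Path zero    (suc j) = ∃ λ k → R zero (suc k) × Rˢ* k j
  Path zero    zero    = R zero zero ⊎ ∃ λ k → ∃ λ l → R zero (suc k) × Rˢ* k l × R (suc l) zero

  private
    _◅_ : ∀ {i j l} → Rˢ i j → Rˢ* j l → TransClosure Rˢ i l
    r ◅ inj₁ refl = [ r ]
    r ◅ inj₂ rs   = r ∷ rs

  step⇒Path : ∀ a b → R a b → Path a b
  step⇒Path (suc i) (suc j) r = [ inj₁ r ]
  step⇒Path (suc i) zero    r = i , inj₁ refl , r
  step⇒Path zero    (suc j) r = j , r , inj₁ refl
  step⇒Path zero    zero    r = inj₁ r

  step◅Path : ∀ a b c → R a b → Path b c → Path a c
  step◅Path (suc i) (suc j) (suc l) r p                            = inj₁ r ∷ p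
  step◅Path (suc i) (suc j) zero    r (k , rs , r′)                = k , inj₂ (inj₁ r ◅ rs) , r′
  step◅Path (suc i) zero    (suc l) r (k , r′ , rs)                = inj₂ (r , r′) ◅ rs
  step◅Path (suc i) zero    zero    r (inj₁ _)                     = i , inj₁ refl , r
  step◅Path (suc i) zero    zero    r (inj₂ (k , l , r′ , rs , r″)) = l , inj₂ (inj₂ (r , r′) ◅ rs) , r″
  step◅Path zero    (suc j) (suc l) r p                            = j , r , inj₂ p
  step◅Path zero    (suc j) zero    r (k , rs , r′)                = inj₂ (j , k , r , rs , r′)
  step◅Path zero    zero    (suc l) r p                            = p
  step◅Path zero    zero    zero    r p                            = p

  TransClosure⇒Path : ∀ {a b} → TransClosure R a b → Path a b
  TransClosure⇒Path {a} {b} [ r ]              = step⇒Path a b r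
  TransClosure⇒Path {a} {c} (_∷_ {y = b} r rs) = step◅Path a b c r (TransClosure⇒Path rs)

  lift : ∀ {i j} → TransClosure Rˢ i j → TransClosure R (suc i) (suc j)
  lift [ inj₁ r ]             = [ r ]
  lift [ inj₂ (r , r′) ]      = r ∷ [ r′ ]
  lift (inj₁ r ∷ rs)          = r ∷ lift rs
  lift (inj₂ (r , r′) ∷ rs)   = r ∷ r′ ∷ lift rs

  _▻*_ : ∀ {a i j} → TransClosure R a (suc i) → Rˢ* i j → TransClosure R a (suc j)
  rs ▻* inj₁ refl = rs
  rs ▻* inj₂ rs′  = rs ++ lift rs′

  Path⇒TransClosure : ∀ a b → Path a b → TransClosure R a b
  Path⇒TransClosure (suc i) (suc j) p                            = lift p
  Path⇒TransClosure (suc i) zero    (k , inj₁ refl , r)          = [ r ]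
  Path⇒TransClosure (suc i) zero    (k , inj₂ rs , r)            = lift rs ∷ʳ r
  Path⇒TransClosure zero    (suc j) (k , r , rs)                 = [ r ] ▻* rs
  Path⇒TransClosure zero    zero    (inj₁ r)                     = [ r ]
  Path⇒TransClosure zero    zero    (inj₂ (k , l , r , rs , r′)) = ([ r ] ▻* rs) ∷ʳ r′

transClosure?ᶠ : ∀ {m} {R : Rel (Fin m) 0ℓ} → Decidable R → Decidable (TransClosure R)
transClosure?ᶠ {zero}  R? ()
transClosure?ᶠ {suc m} {R} R? a b = map′ (Path⇒TransClosure a b) TransClosure⇒Path (path? a b)
  where
  open EliminateZero R
  Rˢ? : Decidable Rˢ
  Rˢ? i j = R? (suc i) (suc j) ⊎-dec (R? (suc i) zero ×-dec R? zero (suc j))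
  Rˢ*? : Decidable Rˢ*
  Rˢ*? i j = (i ≟ᶠ j) ⊎-dec transClosure?ᶠ Rˢ? i j
  path? : Decidable Path
  path? (suc i) (suc j) = transClosure?ᶠ Rˢ? i j
  path? (suc i) zero    = any? λ k → Rˢ*? i k ×-dec R? (suc k) zero
  path? zero    (suc j) = any? λ k → R? zero (suc k) ×-dec Rˢ*? k j
  path? zero    zero    = R? zero zero ⊎-dec any? λ k → any? λ l → R? zero (suc k) ×-dec Rˢ*? k l ×-dec R? (suc l) zero

Finite : Set → Set
Finite A = ∃ λ k → Fin k ↔ A

transClosure? : ∀ {A : Set} {R : Rel A 0ℓ} → Finite A → Decidable R → Decidable (TransClosure R)
transClosure? {R = R} (k , e) R? a b =
  map′ (λ rs → subst₂ (TransClosure R) (strictlyInverseˡ a) (strictlyInverseˡ b) (TransClosure-map to id rs))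
       (TransClosure-map from λ {a} {b} → subst₂ R (sym (strictlyInverseˡ a)) (sym (strictlyInverseˡ b)))
       (transClosure?ᶠ (λ i j → R? (to i) (to j)) (from a) (from b))
  where open Inverse e

finite-↔ : ∀ {A B : Set} → Finite A → A ↔ B → Finite B
finite-↔ (k , e) f = k , ↔-trans e f

finite-× : ∀ {A B : Set} → Finite A → Finite B → Finite (A × B)
finite-× (k , e) (l , f) = k * l , ↔-trans *↔× (e ×-↔ f)

finite-Vec : ∀ {A : Set} → Finite A → ∀ n → Finite (Vec A n)
finite-Vec fin zero    = finite-↔ (1 , 1↔⊤) (mk↔ₛ′ (λ _ → []) (λ _ → tt) (λ { [] → refl }) (λ _ → refl))
finite-Vec fin (suc n) = finite-↔ (finite-× fin (finite-Vec fin n))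
  (mk↔ₛ′ (λ (a , as) → a ∷ as) (λ { (a ∷ as) → a , as }) (λ { (a ∷ as) → refl }) (λ { (a , as) → refl }))

finite-Vals : ∀ n ss → Finite (Vals n ss)
finite-Vals n []       = finite-↔ (1 , 1↔⊤) (mk↔ₛ′ (λ _ → []) (λ _ → tt) (λ { [] → refl }) (λ _ → refl))
finite-Vals n (s ∷ ss) = finite-↔ (finite-× (finite-Val s) (finite-Vals n ss))
  (mk↔ₛ′ (λ (a , as) → a ∷ as) (λ { (a ∷ as) → a , as }) (λ { (a ∷ as) → refl }) (λ { (a , as) → refl }))
  where
  finite-Val : ∀ s → Finite (Val n s)
  finite-Val fo = n , ↔-refl
  finite-Val so = finite-Vec (2 , 2↔Bool) n

sat? : ∀ {n} (ρ : Assign n) φ → Dec (Sat ρ φ)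
sat? ρ (x ≐ y)   = foI ρ x ≟ᶠ foI ρ y
sat? ρ (mem X x) = foI ρ x ∈? soI ρ X
sat? ρ (¬' φ)    = ¬? (sat? ρ φ)
sat? ρ (φ ∨' ψ)  = sat? ρ φ ⊎-dec sat? ρ ψ
sat? ρ (∃₁ x φ)  = any? λ a → sat? (upd ρ fo x a) φ
sat? ρ (∃₂ X φ)  = anySubset? λ A → sat? (upd ρ so X A) φ
sat? {n} ρ (TC ss X X′ Y Y′ φ) =
  transClosure? (finite-Vals n ss) (λ R R′ → sat? (updTup (updTup ρ X R) X′ R′) φ) (getTup ρ Y) (getTup ρ Y′)

-- Coincidence

maxVarᵗ : ∀ {ss} → Tup ss → ℕ
maxVarᵗ []       = 0
maxVarᵗ (v ∷ vs) = v ⊔ maxVarᵗ vs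

maxVar : Form → ℕ
maxVar (x ≐ y)              = x ⊔ y
maxVar (mem X x)            = X ⊔ x
maxVar (¬' φ)               = maxVar φ
maxVar (φ ∨' ψ)             = maxVar φ ⊔ maxVar ψ
maxVar (∃₁ x φ)             = maxVar φ
maxVar (∃₂ X φ)             = maxVar φ
maxVar (TC ss X X′ Y Y′ φ)  = maxVarᵗ Y ⊔ (maxVarᵗ Y′ ⊔ maxVar φ)

VarsBelowᵗ : ∀ {ss} → ℕ → Tup ss → Set
VarsBelowᵗ k []       = ⊤
VarsBelowᵗ k (v ∷ vs) = v < k × VarsBelowᵗ k vs

-- Variables bound by ∃ or TC are not constrained: the coincidence lemma
-- updates them identically on both sides.
VarsBelow : ℕ → Form → Set
VarsBelow k (x ≐ y)             = x < k × y < k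
VarsBelow k (mem X x)           = X < k × x < k
VarsBelow k (¬' φ)              = VarsBelow k φ
VarsBelow k (φ ∨' ψ)            = VarsBelow k φ × VarsBelow k ψ
VarsBelow k (∃₁ x φ)            = VarsBelow k φ
VarsBelow k (∃₂ X φ)            = VarsBelow k φ
VarsBelow k (TC ss X X′ Y Y′ φ) = VarsBelowᵗ k Y × VarsBelowᵗ k Y′ × VarsBelow k φ

maxVarᵗ<⇒VarsBelowᵗ : ∀ {k ss} (t : Tup ss) → maxVarᵗ t < k → VarsBelowᵗ k t
maxVarᵗ<⇒VarsBelowᵗ []       _ = tt
maxVarᵗ<⇒VarsBelowᵗ (v ∷ vs) p = m⊔n<o⇒m<o v _ p , maxVarᵗ<⇒VarsBelowᵗ vs (m⊔n<o⇒n<o v _ p)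

maxVar<⇒VarsBelow : ∀ {k} φ → maxVar φ < k → VarsBelow k φ
maxVar<⇒VarsBelow (x ≐ y)   p = m⊔n<o⇒m<o x _ p , m⊔n<o⇒n<o x _ p
maxVar<⇒VarsBelow (mem X x) p = m⊔n<o⇒m<o X _ p , m⊔n<o⇒n<o X _ p
maxVar<⇒VarsBelow (¬' φ)    p = maxVar<⇒VarsBelow φ p
maxVar<⇒VarsBelow (φ ∨' ψ)  p =
  maxVar<⇒VarsBelow φ (m⊔n<o⇒m<o (maxVar φ) _ p) , maxVar<⇒VarsBelow ψ (m⊔n<o⇒n<o (maxVar φ) _ p)
maxVar<⇒VarsBelow (∃₁ x φ)  p = maxVar<⇒VarsBelow φ p
maxVar<⇒VarsBelow (∃₂ X φ)  p = maxVar<⇒VarsBelow φ p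
maxVar<⇒VarsBelow (TC ss X X′ Y Y′ φ) p =
  maxVarᵗ<⇒VarsBelowᵗ Y (m⊔n<o⇒m<o (maxVarᵗ Y) _ p) ,
  maxVarᵗ<⇒VarsBelowᵗ Y′ (m⊔n<o⇒m<o (maxVarᵗ Y′) _ p′) ,
  maxVar<⇒VarsBelow φ (m⊔n<o⇒n<o (maxVarᵗ Y′) _ p′)
  where p′ = m⊔n<o⇒n<o (maxVarᵗ Y) _ p

AgreeBelow : ∀ {n} → ℕ → Assign n → Assign n → Set
AgreeBelow k ρ σ = (∀ v → v < k → foI ρ v ≡ foI σ v) × (∀ v → v < k → soI ρ v ≡ soI σ v)

AgreeBelow-refl : ∀ {n k} (ρ : Assign n) → AgreeBelow k ρ ρ
AgreeBelow-refl ρ = (λ _ _ → refl) , (λ _ _ → refl)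

AgreeBelow-sym : ∀ {n k} {ρ σ : Assign n} → AgreeBelow k ρ σ → AgreeBelow k σ ρ
AgreeBelow-sym (f , g) = (λ v p → sym (f v p)) , (λ v p → sym (g v p))

AgreeBelow-upd : ∀ {n k} {ρ σ : Assign n} → AgreeBelow k ρ σ → ∀ s v a → AgreeBelow k (upd ρ s v a) (upd σ s v a)
AgreeBelow-upd (f , g) fo v a = f′ , g
  where
  f′ : ∀ u → u < _ → foI (upd _ fo v a) u ≡ foI (upd _ fo v a) u
  f′ u p with u ≟ v
  ... | yes _ = refl
  ... | no  _ = f u p
AgreeBelow-upd (f , g) so v a = f , g′
  where
  g′ : ∀ u → u < _ → soI (upd _ so v a) u ≡ soI (upd _ so v a) u
  g′ u p with u ≟ v
  ... | yes _ = refl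
  ... | no  _ = g u p

AgreeBelow-updTup : ∀ {n k ss} {ρ σ : Assign n} → AgreeBelow k ρ σ →
                    (t : Tup ss) (as : Vals n ss) → AgreeBelow k (updTup ρ t as) (updTup σ t as)
AgreeBelow-updTup ag []                  []       = ag
AgreeBelow-updTup ag (_∷_ {s = s} v t) (a ∷ as) = AgreeBelow-updTup (AgreeBelow-upd ag s v a) t as

getTup-AgreeBelow : ∀ {n k ss} {ρ σ : Assign n} → AgreeBelow k ρ σ →
                    (t : Tup ss) → VarsBelowᵗ k t → getTup ρ t ≡ getTup σ t
getTup-AgreeBelow ag      []                 _       = refl
getTup-AgreeBelow (f , g) (_∷_ {s = fo} v t) (p , q) = cong₂ _∷_ (f v p) (getTup-AgreeBelow (f , g) t q)
getTup-AgreeBelow (f , g) (_∷_ {s = so} v t) (p , q) = cong₂ _∷_ (g v p) (getTup-AgreeBelow (f , g) t q)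

coincidence : ∀ {n k} {ρ σ : Assign n} → AgreeBelow k ρ σ → ∀ φ → VarsBelow k φ → Sat ρ φ → Sat σ φ
coincidence (f , g) (x ≐ y)   (p , q) s = trans (sym (f x p)) (trans s (f y q))
coincidence (f , g) (mem X x) (p , q) s = subst₂ _∈_ (f x q) (g X p) s
coincidence ag (¬' φ)   b       s         = λ s′ → s (coincidence (AgreeBelow-sym ag) φ b s′)
coincidence ag (φ ∨' ψ) (b , c) (inj₁ s)  = inj₁ (coincidence ag φ b s)
coincidence ag (φ ∨' ψ) (b , c) (inj₂ s)  = inj₂ (coincidence ag ψ c s)
coincidence ag (∃₁ x φ) b       (a , s)   = a , coincidence (AgreeBelow-upd ag fo x a) φ b s
coincidence ag (∃₂ X φ) b       (A , s)   = A , coincidence (AgreeBelow-upd ag so X A) φ b s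
coincidence ag (TC ss X X′ Y Y′ φ) (bY , bY′ , b) s
  rewrite sym (getTup-AgreeBelow ag Y bY) | sym (getTup-AgreeBelow ag Y′ bY′) =
  TransClosure-map id (λ {R} {R′} → coincidence (AgreeBelow-updTup (AgreeBelow-updTup ag X R) X′ R′) φ b) s

get-upd-≡ : ∀ {n} (ρ : Assign n) s v a → get (upd ρ s v a) s v ≡ a
get-upd-≡ ρ fo v a with v ≟ v
... | yes _  = refl
... | no v≢v = ⊥-elim (v≢v refl)
get-upd-≡ ρ so v a with v ≟ v
... | yes _  = refl
... | no v≢v = ⊥-elim (v≢v refl)

get-upd-≢ : ∀ {n} (ρ : Assign n) s {u v} a → u ≢ v → get (upd ρ s v a) s u ≡ get ρ s u
get-upd-≢ ρ fo {u} {v} a u≢v with u ≟ v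
... | yes u≡v = ⊥-elim (u≢v u≡v)
... | no  _   = refl
get-upd-≢ ρ so {u} {v} a u≢v with u ≟ v
... | yes u≡v = ⊥-elim (u≢v u≡v)
... | no  _   = refl

AgreeBelow-upd-fresh : ∀ {n k v} {ρ σ : Assign n} s a → k ≤ v → AgreeBelow k ρ σ → AgreeBelow k (upd ρ s v a) σ
AgreeBelow-upd-fresh {ρ = ρ} fo a k≤v (f , g) =
  (λ u u<k → trans (get-upd-≢ ρ fo a (<⇒≢ (<-≤-trans u<k k≤v))) (f u u<k)) , g
AgreeBelow-upd-fresh {ρ = ρ} so a k≤v (f , g) =
  f , (λ u u<k → trans (get-upd-≢ ρ so a (<⇒≢ (<-≤-trans u<k k≤v))) (g u u<k))

-- Derived connectives

infixr 6 _∧'_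
infix  5 _⇔'_

_∧'_ : Form → Form → Form
α ∧' β = ¬' (¬' α ∨' ¬' β)

_⇔'_ : Form → Form → Form
α ⇔' β = (¬' α ∨' β) ∧' (¬' β ∨' α)

∀₁ : ℕ → Form → Form
∀₁ v α = ¬' (∃₁ v (¬' α))

comprehension : ℕ → ℕ → Form → Form
comprehension X v α = ∀₁ v (mem X v ⇔' α)

WF-comprehension : ∀ X v α → WF α → WF (comprehension X v α)
WF-comprehension X v α wf-α = (tt , wf-α) , (wf-α , tt)

Π-⇔ : ∀ {A : Set} {P Q : A → Set} → (∀ a → P a ⇔ Q a) → (∀ a → P a) ⇔ (∀ a → Q a)
Π-⇔ P⇔Q = mk⇔ (λ p a → Equivalence.to (P⇔Q a) (p a)) (λ q a → Equivalence.from (P⇔Q a) (q a))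

∃-⇔ : ∀ {A : Set} {P Q : A → Set} → (∀ a → P a ⇔ Q a) → ∃ P ⇔ ∃ Q
∃-⇔ P⇔Q = Σ-⇔ (↠-id _) (P⇔Q _)

¬⊎⇔→ : ∀ {A B : Set} → Dec A → (¬ A ⊎ B) ⇔ (A → B)
¬⊎⇔→ {A} {B} A? = mk⇔ to from
  where
  to : ¬ A ⊎ B → A → B
  to (inj₁ ¬a) a = ⊥-elim (¬a a)
  to (inj₂ b)  _ = b
  from : (A → B) → ¬ A ⊎ B
  from f = case A? of λ where
    (yes a) → inj₂ (f a)
    (no ¬a) → inj₁ ¬a

module ⇔-Reasoning = EquationalReasoning {k = equivalence}

module _ {n : ℕ} where

  Sat-∧ : ∀ (σ : Assign n) α β → Sat σ (α ∧' β) ⇔ (Sat σ α × Sat σ β)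
  Sat-∧ σ α β = mk⇔
    (λ s → decidable-stable (sat? σ α) (s ∘ inj₁) , decidable-stable (sat? σ β) (s ∘ inj₂))
    (λ (a , b) → λ { (inj₁ ¬a) → ¬a a ; (inj₂ ¬b) → ¬b b })

  Sat-⇔ : ∀ (σ : Assign n) α β → Sat σ (α ⇔' β) ⇔ (Sat σ α ⇔ Sat σ β)
  Sat-⇔ σ α β = begin
    Sat σ (α ⇔' β)                                  ∼⟨ Sat-∧ σ (¬' α ∨' β) (¬' β ∨' α) ⟩
    ((¬ Sat σ α ⊎ Sat σ β) × (¬ Sat σ β ⊎ Sat σ α)) ∼⟨ ¬⊎⇔→ (sat? σ α) ×-⇔ ¬⊎⇔→ (sat? σ β) ⟩
    ((Sat σ α → Sat σ β) × (Sat σ β → Sat σ α))     ∼⟨ mk⇔ (uncurry mk⇔) (λ e → Equivalence.to e , Equivalence.from e) ⟩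
    (Sat σ α ⇔ Sat σ β)                             ∎
    where open ⇔-Reasoning

  Sat-∀₁ : ∀ (σ : Assign n) v α → Sat σ (∀₁ v α) ⇔ (∀ a → Sat (upd σ fo v a) α)
  Sat-∀₁ σ v α = mk⇔ (λ s a → decidable-stable (sat? (upd σ fo v a) α) (λ ¬s → s (a , ¬s)))
                   (λ h (a , ¬s) → ¬s (h a))

  Sat-mem : ∀ (σ : Assign n) X v {a} → foI σ v ≡ a → Sat σ (mem X v) ⇔ (a ∈ soI σ X)
  Sat-mem σ X v refl = ⇔-refl

  Sat-≐ : ∀ (σ : Assign n) u v {a b} → foI σ u ≡ a → foI σ v ≡ b → Sat σ (u ≐ v) ⇔ (a ≡ b)
  Sat-≐ σ u v refl refl = ⇔-refl

  Sat-comprehension : ∀ (σ : Assign n) X v α →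
                      Sat σ (comprehension X v α) ⇔ (∀ a → a ∈ soI σ X ⇔ Sat (upd σ fo v a) α)
  Sat-comprehension σ X v α = begin
    Sat σ (comprehension X v α)
      ∼⟨ Sat-∀₁ σ v (mem X v ⇔' α) ⟩
    (∀ a → Sat (upd σ fo v a) (mem X v ⇔' α))
      ∼⟨ Π-⇔ (λ a → Sat-⇔ (upd σ fo v a) (mem X v) α) ⟩
    (∀ a → Sat (upd σ fo v a) (mem X v) ⇔ Sat (upd σ fo v a) α)
      ∼⟨ Π-⇔ (λ a → Related-cong (Sat-mem (upd σ fo v a) X v (get-upd-≡ σ fo v a)) ⇔-refl) ⟩
    (∀ a → a ∈ soI σ X ⇔ Sat (upd σ fo v a) α)
      ∎
    where open ⇔-Reasoning

-- Equinumerosity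

TransClosure-preserves : ∀ {A : Set} {R : Rel A 0ℓ} (P : A → Set) → (∀ {a b} → R a b → P a → P b) →
                         ∀ {a b} → TransClosure R a b → P a → P b
TransClosure-preserves P step [ r ]    = step r
TransClosure-preserves P step (r ∷ rs) = TransClosure-preserves P step rs ∘ step r

module _ {n : ℕ} where

  Equinumerous-refl : (P : Fin n → Set) → Equinumerous P P
  Equinumerous-refl P = id , (λ _ Pa → Pa) , (λ _ _ _ _ e → e) , (λ b Pb → b , Pb , refl)

  Equinumerous-resp-⇔ : ∀ {P P′ Q Q′ : Fin n → Set} → (∀ a → P a ⇔ P′ a) → (∀ b → Q b ⇔ Q′ b) →
                        Equinumerous P Q → Equinumerous P′ Q′
  Equinumerous-resp-⇔ P⇔P′ Q⇔Q′ (f , maps , inj , onto) =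
    f , (λ a P′a → to (Q⇔Q′ (f a)) (maps a (from (P⇔P′ a) P′a))) ,
        (λ a a′ P′a P′a′ → inj a a′ (from (P⇔P′ a) P′a) (from (P⇔P′ a′) P′a′)) ,
        (λ b Q′b → let (a , Pa , fa≡b) = onto b (from (Q⇔Q′ b) Q′b) in a , to (P⇔P′ a) Pa , fa≡b)
    where open Equivalence

  Equinumerous-insert : ∀ {P Q : Fin n → Set} {c d} → ¬ P c → ¬ Q d → Equinumerous P Q →
                        Equinumerous (λ u → P u ⊎ u ≡ c) (λ u → Q u ⊎ u ≡ d)
  Equinumerous-insert {P} {Q} {c} {d} ¬Pc ¬Qd (f , maps , inj , onto) = g , g-maps , g-inj , g-onto
    where
    g : Fin n → Fin n
    g u with u ≟ᶠ c
    ... | yes _ = d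
    ... | no  _ = f u
    g-old : ∀ {u} → P u → g u ≡ f u
    g-old {u} Pu with u ≟ᶠ c
    ... | yes refl = ⊥-elim (¬Pc Pu)
    ... | no  _    = refl
    g-new : g c ≡ d
    g-new with c ≟ᶠ c
    ... | yes _   = refl
    ... | no  c≢c = ⊥-elim (c≢c refl)
    ¬g-old≡d : ∀ {u} → P u → g u ≢ d
    ¬g-old≡d {u} Pu gu≡d = ¬Qd (subst Q (trans (sym (g-old Pu)) gu≡d) (maps u Pu))
    g-maps : ∀ u → P u ⊎ u ≡ c → Q (g u) ⊎ g u ≡ d
    g-maps u (inj₁ Pu)   = inj₁ (subst Q (sym (g-old Pu)) (maps u Pu))
    g-maps u (inj₂ refl) = inj₂ g-new
    g-inj : ∀ u u′ → P u ⊎ u ≡ c → P u′ ⊎ u′ ≡ c → g u ≡ g u′ → u ≡ u′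
    g-inj u u′ (inj₁ Pu)   (inj₁ Pu′)  e = inj u u′ Pu Pu′ (trans (sym (g-old Pu)) (trans e (g-old Pu′)))
    g-inj u _  (inj₁ Pu)   (inj₂ refl) e = ⊥-elim (¬g-old≡d Pu (trans e g-new))
    g-inj _ u′ (inj₂ refl) (inj₁ Pu′)  e = ⊥-elim (¬g-old≡d Pu′ (trans (sym e) g-new))
    g-inj _ _  (inj₂ refl) (inj₂ refl) _ = refl
    g-onto : ∀ v → Q v ⊎ v ≡ d → ∃ λ u → (P u ⊎ u ≡ c) × g u ≡ v
    g-onto v (inj₁ Qv) with onto v Qv
    ... | u , Pu , fu≡v = u , inj₁ Pu , trans (g-old Pu) fu≡v
    g-onto v (inj₂ refl) = c , inj₂ refl , g-new

  Equinumerous-remove : ∀ {P Q : Fin n → Set} {a} → Equinumerous P Q → P a →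
                        ∃ λ b → Q b × Equinumerous (λ u → P u × u ≢ a) (λ u → Q u × u ≢ b)
  Equinumerous-remove {a = a} (f , maps , inj , onto) Pa =
    f a , maps a Pa ,
    f , (λ u (Pu , u≢a) → maps u Pu , u≢a ∘ inj u a Pu Pa) ,
        (λ u u′ (Pu , _) (Pu′ , _) → inj u u′ Pu Pu′) ,
        (λ v (Qv , v≢fa) → let (u , Pu , fu≡v) = onto v Qv in
                           u , (Pu , λ u≡a → v≢fa (trans (sym fu≡v) (cong f u≡a))) , fu≡v)

x∉p-x : ∀ {n} (p : Subset n) x → x ∉ p - x
x∉p-x (s ∷ p) zero    ()
x∉p-x (s ∷ p) (suc x) (there x∈p-x) = x∉p-x p x x∈p-x

module _ {n : ℕ} where

  SameSize : Subset n → Subset n → Set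
  SameSize p q = Equinumerous (_∈ p) (_∈ q)

  Subset-ext : ∀ {p q : Subset n} → (∀ x → x ∈ p ⇔ x ∈ q) ⇔ (p ≡ q)
  Subset-ext = mk⇔ (λ p⇔q → ⊆-antisym (Equivalence.to (p⇔q _)) (Equivalence.from (p⇔q _))) λ { refl _ → ⇔-refl }

  ∈-∪⁅⁆ : ∀ {p : Subset n} {x y} → x ∈ p ∪ ⁅ y ⁆ ⇔ (x ∈ p ⊎ x ≡ y)
  ∈-∪⁅⁆ = ⇔-trans ∪⇔⊎ (⇔-refl ⊎-⇔ x∈⁅y⁆⇔x≡y)

  ∈-remove : ∀ {p : Subset n} {x y} → x ∈ p - y ⇔ (x ∈ p × x ≢ y)
  ∈-remove {p} {x} {y} =
    mk⇔ (λ x∈p-y → p─q⊆p p ⁅ y ⁆ x∈p-y , λ { refl → x∉p-x p x x∈p-y })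
        (λ (x∈p , x≢y) → x∈p∧x≢y⇒x∈p-y x∈p x≢y)

  remove-insert : ∀ {p : Subset n} {x} → x ∈ p → (p - x) ∪ ⁅ x ⁆ ≡ p
  remove-insert {p} {x} x∈p =
    Equivalence.to Subset-ext λ y → mk⇔ (to y ∘ Equivalence.to ∈-∪⁅⁆) (Equivalence.from ∈-∪⁅⁆ ∘ from y)
    where
    to : ∀ y → y ∈ p - x ⊎ y ≡ x → y ∈ p
    to y (inj₁ y∈p-x) = proj₁ (Equivalence.to ∈-remove y∈p-x)
    to y (inj₂ refl)  = x∈p
    from : ∀ y → y ∈ p → y ∈ p - x ⊎ y ≡ x
    from y y∈p with y ≟ᶠ x
    ... | yes y≡x = inj₂ y≡x
    ... | no  y≢x = inj₁ (Equivalence.from ∈-remove (y∈p , y≢x))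

  Grow : Rel (Subset n × Subset n) 0ℓ
  Grow (p , q) (p′ , q′) =
    (∃ λ c → ∃ λ d → c ∉ p × d ∉ q × p′ ≡ p ∪ ⁅ c ⁆ × q′ ≡ q ∪ ⁅ d ⁆) ⊎ (p′ ≡ p × q′ ≡ q)

  Grow-preserves-SameSize : ∀ {pq pq′} → Grow pq pq′ → uncurry SameSize pq → uncurry SameSize pq′
  Grow-preserves-SameSize (inj₁ (_ , _ , c∉p , d∉q , refl , refl)) =
    Equinumerous-resp-⇔ (λ _ → ⇔-sym ∈-∪⁅⁆) (λ _ → ⇔-sym ∈-∪⁅⁆) ∘ Equinumerous-insert c∉p d∉q
  Grow-preserves-SameSize (inj₂ (refl , refl)) = id

  Grow⁺⇒SameSize : ∀ {r p q} → TransClosure Grow (r , r) (p , q) → SameSize p q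
  Grow⁺⇒SameSize {r} g = TransClosure-preserves (uncurry SameSize) Grow-preserves-SameSize g (Equinumerous-refl (_∈ r))

  SameSize⇒Grow⁺ : ∀ {p q} → SameSize p q → TransClosure Grow (⊥ , ⊥) (p , q)
  SameSize⇒Grow⁺ = grow (<-wellFounded _)
    where
    grow : ∀ {p q} → Acc _<_ ∣ p ∣ → SameSize p q → TransClosure Grow (⊥ , ⊥) (p , q)
    grow {p} {q} (acc smaller) p≈q@(_ , _ , _ , onto) with nonempty? p
    ... | no p-empty =
      subst₂ (λ p q → TransClosure Grow (⊥ , ⊥) (p , q)) (sym (Empty-unique p-empty)) (sym (Empty-unique q-empty))
        [ inj₂ (refl , refl) ]
      where
      q-empty : Empty q
      q-empty (b , b∈q) = let (a , a∈p , _) = onto b b∈q in p-empty (a , a∈p)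
    ... | yes (a , a∈p) with Equinumerous-remove p≈q a∈p
    ... | b , b∈q , p-a≈q-b =
      subst₂ (λ p q → TransClosure Grow (⊥ , ⊥) (p , q)) (remove-insert a∈p) (remove-insert b∈q)
        (grow (smaller (x∈p⇒∣p-x∣<∣p∣ a∈p))
              (Equinumerous-resp-⇔ (λ _ → ⇔-sym ∈-remove) (λ _ → ⇔-sym ∈-remove) p-a≈q-b)
         ∷ʳ inj₁ (a , b , x∉p-x p a , x∉p-x q b , refl , refl))

subset : ∀ {n} {P : Fin n → Set} → Decidable₁ P → Subset n
subset P? = tabulate (isYes ∘ P?)

∈-subset : ∀ {n} {P : Fin n → Set} (P? : Decidable₁ P) {i} → i ∈ subset P? ⇔ P i
∈-subset P? {i} = begin
  i ∈ subset P?                                 ∼⟨ ↔⇒⇔ []=↔lookup ⟩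
  (lookup (subset P?) i ≡ true)                 ≡⟨ cong (_≡ true) (lookup∘tabulate (isYes ∘ P?) i) ⟩
  (isYes (P? i) ≡ true)                         ∼⟨ ⇔-sym T-≡ ⟩
  True (P? i)                                   ∼⟨ mk⇔ toWitness fromWitness ⟩
  _                                             ∎
  where open ⇔-Reasoning

module _ {n : ℕ} where

  Sat-comprehension-≡ : ∀ (σ : Assign n) X v α {p} → (∀ a → Sat (upd σ fo v a) α ⇔ a ∈ p) →
                        Sat σ (comprehension X v α) ⇔ (soI σ X ≡ p)
  Sat-comprehension-≡ σ X v α α⇔∈p =
    ⇔-trans (Sat-comprehension σ X v α) (⇔-trans (Π-⇔ λ a → Related-cong ⇔-refl (α⇔∈p a)) Subset-ext)

  Sat-comprehension-mem : ∀ (σ : Assign n) X′ X w → Sat σ (comprehension X′ w (mem X w)) ⇔ (soI σ X′ ≡ soI σ X)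
  Sat-comprehension-mem σ X′ X w =
    Sat-comprehension-≡ σ X′ w (mem X w) λ a → Sat-mem (upd σ fo w a) X w (get-upd-≡ σ fo w a)

  Sat-comprehension-∪⁅⁆ : ∀ (σ : Assign n) X′ X w v {e} → v ≢ w → foI σ v ≡ e →
                          Sat σ (comprehension X′ w (mem X w ∨' (w ≐ v))) ⇔ (soI σ X′ ≡ soI σ X ∪ ⁅ e ⁆)
  Sat-comprehension-∪⁅⁆ σ X′ X w v v≢w σv≡e = Sat-comprehension-≡ σ X′ w (mem X w ∨' (w ≐ v)) λ a →
    ⇔-trans (Sat-mem (upd σ fo w a) X w (get-upd-≡ σ fo w a) ⊎-⇔
             Sat-≐ (upd σ fo w a) w v (get-upd-≡ σ fo w a) (trans (get-upd-≢ σ fo a v≢w) σv≡e))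
            (⇔-sym ∈-∪⁅⁆)

-- The formula χ

module HaertigFormula (x y : ℕ) (φ ψ : Form) where

  k : ℕ
  k = suc (x ⊔ y ⊔ maxVar φ ⊔ maxVar ψ)

  private
    x⊔y⊔φ<k : x ⊔ y ⊔ maxVar φ < k
    x⊔y⊔φ<k = m⊔n<o⇒m<o _ (maxVar ψ) ≤-refl

  x<k : x < k
  x<k = m⊔n<o⇒m<o x y (m⊔n<o⇒m<o _ (maxVar φ) x⊔y⊔φ<k)

  y<k : y < k
  y<k = m⊔n<o⇒n<o x y (m⊔n<o⇒m<o _ (maxVar φ) x⊔y⊔φ<k)

  φ-below : VarsBelow k φ
  φ-below = maxVar<⇒VarsBelow φ (m⊔n<o⇒n<o _ (maxVar φ) x⊔y⊔φ<k)

  ψ-below : VarsBelow k ψ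
  ψ-below = maxVar<⇒VarsBelow ψ (m⊔n<o⇒n<o _ (maxVar ψ) ≤-refl)

  fresh-≢ : ∀ {i j} → i ≢ j → i + k ≢ j + k
  fresh-≢ {i} {j} i≢j = i≢j ∘ +-cancelʳ-≡ k i j

  -- Fresh variables; first-order and set variables have separate namespaces.
  c d w : ℕ
  c = 0 + k
  d = 1 + k
  w = 2 + k

  P Q S A B A′ B′ : ℕ
  P  = 0 + k
  Q  = 1 + k
  S  = 2 + k
  A  = 3 + k
  B  = 4 + k
  A′ = 5 + k
  B′ = 6 + k

  -- θ[c/v], for θ not mentioning c
  at : ℕ → Form → Form
  at v θ = ∃₁ v ((v ≐ c) ∧' θ)

  extend : ℕ → ℕ → ℕ → Form
  extend X′ X v = comprehension X′ w (mem X w ∨' (w ≐ v))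

  copy : ℕ → ℕ → Form
  copy X′ X = comprehension X′ w (mem X w)

  grow : Form
  grow = ∃₁ c (∃₁ d (¬' (mem A c) ∧' ¬' (mem B d) ∧' extend A′ A c ∧' extend B′ B d))
      ∨' (copy A′ A ∧' copy B′ B)

  chain : Form
  chain = TC (so ∷ so ∷ []) (A ∷ B ∷ []) (A′ ∷ B′ ∷ []) (S ∷ S ∷ []) (P ∷ Q ∷ []) grow

  body : Form
  body = comprehension P c (at x φ) ∧' comprehension Q c (at y ψ) ∧' chain

  χ : Form
  χ = ∃₂ P (∃₂ Q (∃₂ S body))

  c≢d : c ≢ d
  c≢d = fresh-≢ {0} {1} λ ()

  c≢w : c ≢ w
  c≢w = fresh-≢ {0} {2} λ ()

  d≢w : d ≢ w
  d≢w = fresh-≢ {1} {2} λ ()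

  Sat-at : ∀ {n} {σ ρ : Assign n} → AgreeBelow k σ ρ → ∀ {v θ a} → v < k → VarsBelow k θ → foI σ c ≡ a →
           Sat σ (at v θ) ⇔ Sat (upd ρ fo v a) θ
  Sat-at {σ = σ} {ρ} agree {v} {θ} {a} v<k θ-below σc≡a = mk⇔ to from
    where
    c≢v : c ≢ v
    c≢v c≡v = <⇒≢ v<k (sym c≡v)
    v≐c⇔≡a : ∀ b → Sat (upd σ fo v b) (v ≐ c) ⇔ (b ≡ a)
    v≐c⇔≡a b = Sat-≐ (upd σ fo v b) v c (get-upd-≡ σ fo v b) (trans (get-upd-≢ σ fo b c≢v) σc≡a)
    to : Sat σ (at v θ) → Sat (upd ρ fo v a) θ
    to (b , holds) with Equivalence.to (Sat-∧ (upd σ fo v b) (v ≐ c) θ) holds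
    ... | v≐c , θ-holds = subst (λ b → Sat (upd ρ fo v b) θ) (Equivalence.to (v≐c⇔≡a b) v≐c)
                                (coincidence (AgreeBelow-upd agree fo v b) θ θ-below θ-holds)
    from : Sat (upd ρ fo v a) θ → Sat σ (at v θ)
    from θ-holds = a , Equivalence.from (Sat-∧ (upd σ fo v a) (v ≐ c) θ)
      (Equivalence.from (v≐c⇔≡a a) refl , coincidence (AgreeBelow-sym (AgreeBelow-upd agree fo v a)) θ θ-below θ-holds)

  Sat-defines : ∀ {n} {σ ρ : Assign n} → AgreeBelow k σ ρ → ∀ X {v θ} → v < k → VarsBelow k θ →
                Sat σ (comprehension X c (at v θ)) ⇔ (∀ a → a ∈ soI σ X ⇔ Sat (upd ρ fo v a) θ)
  Sat-defines {σ = σ} agree X {v} {θ} v<k θ-below =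
    ⇔-trans (Sat-comprehension σ X c (at v θ)) (Π-⇔ λ a → Related-cong ⇔-refl
      (Sat-at (AgreeBelow-upd-fresh fo a ≤-refl agree) v<k θ-below (get-upd-≡ σ fo c a)))

  Sat-grow : ∀ {n} (σ : Assign n) → Sat σ grow ⇔ Grow (soI σ A , soI σ B) (soI σ A′ , soI σ B′)
  Sat-grow σ = ∃-⇔ (λ a → ∃-⇔ (Sat-insert a)) ⊎-⇔ Sat-stay
    where
    Sat-insert : ∀ a b →
      Sat (upd (upd σ fo c a) fo d b) (¬' (mem A c) ∧' ¬' (mem B d) ∧' extend A′ A c ∧' extend B′ B d) ⇔
      (a ∉ soI σ A × b ∉ soI σ B × soI σ A′ ≡ soI σ A ∪ ⁅ a ⁆ × soI σ B′ ≡ soI σ B ∪ ⁅ b ⁆)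
    Sat-insert a b =
      ⇔-trans (Sat-∧ τ (¬' (mem A c)) (¬' (mem B d) ∧' extend A′ A c ∧' extend B′ B d))
              (¬-cong-⇔ (Sat-mem τ A c τc≡a) ×-⇔
      ⇔-trans (Sat-∧ τ (¬' (mem B d)) (extend A′ A c ∧' extend B′ B d)) (¬-cong-⇔ (Sat-mem τ B d τd≡b) ×-⇔
      ⇔-trans (Sat-∧ τ (extend A′ A c) (extend B′ B d)) (Sat-comprehension-∪⁅⁆ τ A′ A w c c≢w τc≡a ×-⇔
                                                         Sat-comprehension-∪⁅⁆ τ B′ B w d d≢w τd≡b)))
      where
      τ : Assign _
      τ = upd (upd σ fo c a) fo d b
      τc≡a : foI τ c ≡ a
      τc≡a = trans (get-upd-≢ (upd σ fo c a) fo b c≢d) (get-upd-≡ σ fo c a)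
      τd≡b : foI τ d ≡ b
      τd≡b = get-upd-≡ (upd σ fo c a) fo d b
    Sat-stay : Sat σ (copy A′ A ∧' copy B′ B) ⇔ (soI σ A′ ≡ soI σ A × soI σ B′ ≡ soI σ B)
    Sat-stay = ⇔-trans (Sat-∧ σ (copy A′ A) (copy B′ B))
                       (Sat-comprehension-mem σ A′ A w ×-⇔ Sat-comprehension-mem σ B′ B w)

  module _ {n : ℕ} (σ : Assign n) where

    Step : Rel (Vals n (so ∷ so ∷ [])) 0ℓ
    Step R R′ = Sat (updTup (updTup σ (A ∷ B ∷ []) R) (A′ ∷ B′ ∷ []) R′) grow

    Step⇔Grow : ∀ p q p′ q′ → Step (p ∷ q ∷ []) (p′ ∷ q′ ∷ []) ⇔ Grow (p , q) (p′ , q′)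
    Step⇔Grow p q p′ q′ =
      subst₂ (λ r r′ → Sat τ grow ⇔ Grow r r′) (cong₂ _,_ τA τB) (cong₂ _,_ τA′ τB′) (Sat-grow τ)
      where
      σ₁ σ₂ σ₃ τ : Assign n
      σ₁ = upd σ so A p
      σ₂ = upd σ₁ so B q
      σ₃ = upd σ₂ so A′ p′
      τ  = upd σ₃ so B′ q′
      τB′ : soI τ B′ ≡ q′
      τB′ = get-upd-≡ σ₃ so B′ q′
      τA′ : soI τ A′ ≡ p′
      τA′ = trans (get-upd-≢ σ₃ so q′ (fresh-≢ {5} {6} λ ())) (get-upd-≡ σ₂ so A′ p′)
      τB : soI τ B ≡ q
      τB = trans (get-upd-≢ σ₃ so q′ (fresh-≢ {4} {6} λ ()))
          (trans (get-upd-≢ σ₂ so p′ (fresh-≢ {4} {5} λ ())) (get-upd-≡ σ₁ so B q))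
      τA : soI τ A ≡ p
      τA = trans (get-upd-≢ σ₃ so q′ (fresh-≢ {3} {6} λ ()))
          (trans (get-upd-≢ σ₂ so p′ (fresh-≢ {3} {5} λ ()))
          (trans (get-upd-≢ σ₁ so q (fresh-≢ {3} {4} λ ())) (get-upd-≡ σ so A p)))

    Sat-chain : Sat σ chain ⇔ TransClosure Grow (soI σ S , soI σ S) (soI σ P , soI σ Q)
    Sat-chain = mk⇔ (TransClosure-map pair λ {R} {R′} → step⇒Grow R R′)
                    (TransClosure-map (λ (p , q) → p ∷ q ∷ [])
                                      λ {(p , q)} {(p′ , q′)} → Equivalence.from (Step⇔Grow p q p′ q′))
      where
      pair : Vals n (so ∷ so ∷ []) → Subset n × Subset n
      pair (p ∷ q ∷ []) = p , q
      step⇒Grow : ∀ R R′ → Step R R′ → Grow (pair R) (pair R′)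
      step⇒Grow (p ∷ q ∷ []) (p′ ∷ q′ ∷ []) = Equivalence.to (Step⇔Grow p q p′ q′)

  -- The content of body when P, Q, S denote p, q, s.
  Certificate : ∀ {n} → Assign n → Subset n → Subset n → Subset n → Set
  Certificate ρ p q s = (∀ a → a ∈ p ⇔ Sat (upd ρ fo x a) φ) ×
                        (∀ a → a ∈ q ⇔ Sat (upd ρ fo y a) ψ) ×
                        TransClosure Grow (s , s) (p , q)

  Sat-body : ∀ {n} {σ ρ : Assign n} → AgreeBelow k σ ρ → Sat σ body ⇔ Certificate ρ (soI σ P) (soI σ Q) (soI σ S)
  Sat-body {σ = σ} agree =
    ⇔-trans (Sat-∧ σ (comprehension P c (at x φ)) (comprehension Q c (at y ψ) ∧' chain))
            (Sat-defines agree P x<k φ-below ×-⇔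
    ⇔-trans (Sat-∧ σ (comprehension Q c (at y ψ)) chain)
            (Sat-defines agree Q y<k ψ-below ×-⇔ Sat-chain σ))

  certificate⇔Haertig : ∀ {n} (ρ : Assign n) →
                        (∃ λ p → ∃ λ q → ∃ λ s → Certificate ρ p q s) ⇔ Haertig ρ x φ y ψ
  certificate⇔Haertig ρ = mk⇔ sound complete
    where
    sound : (∃ λ p → ∃ λ q → ∃ λ s → Certificate ρ p q s) → Haertig ρ x φ y ψ
    sound (p , q , s , p-def , q-def , grows) = Equinumerous-resp-⇔ p-def q-def (Grow⁺⇒SameSize grows)
    complete : Haertig ρ x φ y ψ → ∃ λ p → ∃ λ q → ∃ λ s → Certificate ρ p q s
    complete equinumerous = subset φ? , subset ψ? , ⊥ , (λ _ → ∈-subset φ?) , (λ _ → ∈-subset ψ?) ,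
      SameSize⇒Grow⁺ (Equinumerous-resp-⇔ (λ _ → ⇔-sym (∈-subset φ?)) (λ _ → ⇔-sym (∈-subset ψ?))
                                          equinumerous)
      where
      φ? : Decidable₁ λ a → Sat (upd ρ fo x a) φ
      φ? a = sat? (upd ρ fo x a) φ
      ψ? : Decidable₁ λ b → Sat (upd ρ fo y b) ψ
      ψ? b = sat? (upd ρ fo y b) ψ

  Sat-χ : ∀ {n} (ρ : Assign n) → Sat ρ χ ⇔ Haertig ρ x φ y ψ
  Sat-χ {n} ρ = ⇔-trans (∃-⇔ λ p → ∃-⇔ λ q → ∃-⇔ λ s → Sat-body-at p q s) (certificate⇔Haertig ρ)
    where
    Certificate-resp : ∀ {p q s p′ q′ s′} → p ≡ p′ → q ≡ q′ → s ≡ s′ →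
                       Certificate ρ p q s ⇔ Certificate ρ p′ q′ s′
    Certificate-resp refl refl refl = ⇔-refl
    Sat-body-at : ∀ p q s → Sat (upd (upd (upd ρ so P p) so Q q) so S s) body ⇔ Certificate ρ p q s
    Sat-body-at p q s = ⇔-trans (Sat-body agree) (Certificate-resp σP σQ σS)
      where
      σ₁ σ₂ σ : Assign n
      σ₁ = upd ρ so P p
      σ₂ = upd σ₁ so Q q
      σ  = upd σ₂ so S s
      agree : AgreeBelow k σ ρ
      agree = AgreeBelow-upd-fresh so s (m≤n+m k 2) (AgreeBelow-upd-fresh so q (m≤n+m k 1)
                (AgreeBelow-upd-fresh so p ≤-refl (AgreeBelow-refl ρ)))
      σS : soI σ S ≡ s
      σS = get-upd-≡ σ₂ so S s
      σQ : soI σ Q ≡ q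
      σQ = trans (get-upd-≢ σ₂ so s (fresh-≢ {1} {2} λ ())) (get-upd-≡ σ₁ so Q q)
      σP : soI σ P ≡ p
      σP = trans (get-upd-≢ σ₂ so s (fresh-≢ {0} {2} λ ()))
          (trans (get-upd-≢ σ₁ so q (fresh-≢ {0} {1} λ ())) (get-upd-≡ ρ so P p))

  WF-χ : WF φ → WF ψ → WF χ
  WF-χ wf-φ wf-ψ = WF-comprehension P c (at x φ) (tt , wf-φ) , WF-comprehension Q c (at y ψ) (tt , wf-ψ) ,
                   distinct , WF-grow
    where
    so-≢ : ∀ {i j} → i ≢ j → (so , i + k) ≢ (so , j + k)
    so-≢ i≢j = fresh-≢ i≢j ∘ cong proj₂
    distinct : Unique ((so , A) ∷ (so , B) ∷ (so , A′) ∷ (so , B′) ∷ [])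
    distinct = (so-≢ {3} {4} (λ ()) ∷ so-≢ {3} {5} (λ ()) ∷ so-≢ {3} {6} (λ ()) ∷ [])
             ∷ (so-≢ {4} {5} (λ ()) ∷ so-≢ {4} {6} (λ ()) ∷ [])
             ∷ (so-≢ {5} {6} (λ ()) ∷ [])
             ∷ [] ∷ []
    WF-grow : WF grow
    WF-grow = (tt , tt , WF-comprehension A′ w (mem A w ∨' (w ≐ c)) (tt , tt) ,
                         WF-comprehension B′ w (mem B w ∨' (w ≐ d)) (tt , tt)) ,
              (WF-comprehension A′ w (mem A w) tt , WF-comprehension B′ w (mem B w) tt)

mainTheorem6 : (x y : ℕ) (φ ψ : Form) → WF φ → WF ψ →
    Σ Form (λ χ → WF χ × (∀ (n : ℕ) (ρ : Assign n) → Sat ρ χ ⇔ Haertig ρ x φ y ψ))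
mainTheorem6 x y φ ψ wf-φ wf-ψ = χ , WF-χ wf-φ wf-ψ , λ n → Sat-χ
  where open HaertigFormula x y φ ψ
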